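{- Let $a,b\ge 2$ be integers and $n\ge 7$. Let $r=a$, $s=b$ if $n$ is even and $r=b$, $s=a$ if $n$ is odd, and suppose $r$ is even. Then $$f_{(a,b,n)} = \left( f_{(a,b,n-2)}^{s}\, I_{(a,b,n-2)}\, t_{(a,b,n-2)}^{s-1}\right)^{r/2} f_{(a,b,n-2)}.$$
   Context: Words are over the alphabet $\{0,1\}$, with concatenation as the product; $w^k$ denotes the concatenation of $k$ copies of $w$ ($w^0$ is the empty word). For integers $a,b\ge 1$ the biperiodic Fibonacci words are defined by $f_{(a,b,0)}=0$, $f_{(a,b,1)}=0^{a-1}1$, and for $n\ge 2$: $f_{(a,b,n)} = f_{(a,b,n-1)}^{a}f_{(a,b,n-2)}$ if $n$ is even, and $f_{(a,b,n)} = f_{(a,b,n-1)}^{b}f_{(a,b,n-2)}$ if $n$ is odd. For a word $f_{(a,b,n)}$ with at least two letters, write $f_{(a,b,n)} = p\,xy$ with $x,y$ letters; then $t_{(a,b,n)} := p\,yx$. For $m\ge 5$ let $r_m = a$ if $m$ is even and $r_m=b$ if $m$ is odd. With $a,b\ge 2$, $f_{(a,b,m)}$ has suffix $w_m := f_{(a,b,m-1)}^{r_m-2}f_{(a,b,m-2)}$ and $t_{(a,b,m)}$ has prefix $w_m$. The word $I_{(a,b,m)}$ is defined as the word which begins with $f_{(a,b,m)}$ and ends with $t_{(a,b,m)}$, where these two occurrences overlap in exactly $w_m$; i.e. $I_{(a,b,m)} = u\,w_m\,v$ where $f_{(a,b,m)}=u\,w_m$ and $t_{(a,b,m)} = w_m\,v$.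 -}

module Defs where

open import Data.Nat using (ℕ; zero; suc; _∸_; _*_)
open import Data.Bool using (Bool; false; true)
open import Data.List using (List; []; _∷_; _++_; reverse; length; take; drop; replicate)

-- Words over {0,1}: lists of Bool, with false = 0 and true = 1.
Word : Set
Word = List Bool

_^ʷ_ : Word → ℕ → Word
w ^ʷ zero  = []
w ^ʷ suc k = w ++ (w ^ʷ k)

sel : ℕ → ℕ → ℕ → ℕ
sel zero          x y = x
sel (suc zero)    x y = y
sel (suc (suc n)) x y = sel n x y

fib : ℕ → ℕ → ℕ → Word
fib a b zero          = false ∷ []
fib a b (suc zero)    = (false ∷ []) ^ʷ (a ∸ 1) ++ (true ∷ [])
fib a b (suc (suc n)) =
  (fib a b (suc n) ^ʷ sel (suc (suc n)) a b) ++ fib a b n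

swapFront : Word → Word
swapFront (x ∷ y ∷ p) = y ∷ x ∷ p
swapFront w           = w

swapLast : Word → Word
swapLast w = reverse (swapFront (reverse w))

tw : ℕ → ℕ → ℕ → Word
tw a b n = swapLast (fib a b n)

rr : ℕ → ℕ → ℕ → ℕ
rr a b m = sel m a b

ww : ℕ → ℕ → ℕ → Word
ww a b m = (fib a b (m ∸ 1) ^ʷ (rr a b m ∸ 2)) ++ fib a b (m ∸ 2)

-- I_(a,b,m) = u w_m v where f_(a,b,m) = u w_m and t_(a,b,m) = w_m v
-- (u is f with its suffix of length |w_m| removed; v is t with its prefix
--  of length |w_m| removed).
Iw : ℕ → ℕ → ℕ → Word
Iw a b m =
  take (length (fib a b m) ∸ length (ww a b m)) (fib a b m)
  ++ ww a b m
  ++ drop (length (ww a b m)) (tw a b m)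

module Submission where

-- With G = f_{n-2}, H = f_{n-3}, T = t_{n-2}: the words f_j f_{j+1} and f_{j+1} f_j differ
-- only in their last two letters, which gives the conjugation G H = H T and hence
-- G^k H = H T^k. The overlap of f_{n-2} and t_{n-2} in I_{n-2} is everything but a
-- prefix H H, so I_{n-2} = H H T and G^s I T^(s-1) = G^s H H T^s = (G^s H)(G^s H).
-- Since f_{n-1} = G^s H and f_n = f_{n-1}^r G with r = 2h, the identity follows.

open import Defs
open import Data.Nat using (ℕ; zero; suc; _+_; _≤_; _∸_; _*_; z≤n; s≤s)
open import Data.Nat.Properties using (*-suc; <⇒≤; ≤-trans; ≤-reflexive; +-mono-≤; m+n∸n≡m)
open import Data.Bool using (true; false)
open import Data.List using ([]; _∷_; _++_; reverse; length; take; drop)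
open import Data.List.Properties
  using (++-assoc; ++-identityʳ; reverse-++; reverse-involutive; length-++; length-reverse;
         length-++-≤ˡ; length-++-≤ʳ)
open import Data.Product using (_,_; proj₂; ∃-syntax)
open import Relation.Binary.PropositionalEquality
  using (_≡_; refl; sym; trans; cong; subst; module ≡-Reasoning)
open ≡-Reasoning

sel-suc : ∀ m (x y : ℕ) → sel (suc m) x y ≡ sel m y x
sel-suc zero          x y = refl
sel-suc (suc zero)    x y = refl
sel-suc (suc (suc m)) x y = sel-suc m x y

sel-≥ : ∀ {k x y} m → k ≤ x → k ≤ y → k ≤ sel m x y
sel-≥ zero          k≤x k≤y = k≤x
sel-≥ (suc zero)    k≤x k≤y = k≤y
sel-≥ (suc (suc m)) k≤x k≤y = sel-≥ m k≤x k≤y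

^ʷ-suc : ∀ (w : Word) k → w ^ʷ suc k ≡ (w ^ʷ k) ++ w
^ʷ-suc w zero    = ++-identityʳ w
^ʷ-suc w (suc k) = trans (cong (w ++_) (^ʷ-suc w k)) (sym (++-assoc w (w ^ʷ k) w))

^ʷ-2* : ∀ (w : Word) h → w ^ʷ (2 * h) ≡ (w ++ w) ^ʷ h
^ʷ-2* w zero    = refl
^ʷ-2* w (suc h) = begin
  w ^ʷ (2 * suc h)            ≡⟨ cong (w ^ʷ_) (*-suc 2 h) ⟩
  w ++ w ++ w ^ʷ (2 * h)      ≡⟨ sym (++-assoc w w _) ⟩
  (w ++ w) ++ w ^ʷ (2 * h)    ≡⟨ cong ((w ++ w) ++_) (^ʷ-2* w h) ⟩
  (w ++ w) ^ʷ suc h           ∎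

^ʷ-conjugate : ∀ {G H T : Word} → G ++ H ≡ H ++ T → ∀ k → (G ^ʷ k) ++ H ≡ H ++ (T ^ʷ k)
^ʷ-conjugate {G} {H} {T} GH≡HT zero    = sym (++-identityʳ H)
^ʷ-conjugate {G} {H} {T} GH≡HT (suc k) = begin
  (G ++ G ^ʷ k) ++ H    ≡⟨ ++-assoc G (G ^ʷ k) H ⟩
  G ++ (G ^ʷ k ++ H)    ≡⟨ cong (G ++_) (^ʷ-conjugate {G} {H} {T} GH≡HT k) ⟩
  G ++ (H ++ T ^ʷ k)    ≡⟨ sym (++-assoc G H (T ^ʷ k)) ⟩
  (G ++ H) ++ T ^ʷ k    ≡⟨ cong (_++ T ^ʷ k) GH≡HT ⟩
  (H ++ T) ++ T ^ʷ k    ≡⟨ ++-assoc H T (T ^ʷ k) ⟩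
  H ++ T ^ʷ suc k       ∎

conjugate-block : ∀ {G H T : Word} → G ++ H ≡ H ++ T → ∀ s → 1 ≤ s →
  (G ^ʷ s) ++ ((H ++ H) ++ T) ++ (T ^ʷ (s ∸ 1)) ≡ ((G ^ʷ s) ++ H) ++ ((G ^ʷ s) ++ H)
conjugate-block {G} {H} {T} GH≡HT (suc s) _ = begin
  G ^ʷ suc s ++ ((H ++ H) ++ T) ++ T ^ʷ s
    ≡⟨ cong (G ^ʷ suc s ++_) (trans (++-assoc (H ++ H) T _) (++-assoc H H _)) ⟩
  G ^ʷ suc s ++ H ++ H ++ T ^ʷ suc s
    ≡⟨ cong (λ u → G ^ʷ suc s ++ H ++ u) (sym (^ʷ-conjugate {G} {H} {T} GH≡HT (suc s))) ⟩
  G ^ʷ suc s ++ H ++ (G ^ʷ suc s ++ H)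
    ≡⟨ sym (++-assoc (G ^ʷ suc s) H _) ⟩
  (G ^ʷ suc s ++ H) ++ (G ^ʷ suc s ++ H) ∎

swapFront-++ : ∀ (u z : Word) → 2 ≤ length u → swapFront (u ++ z) ≡ swapFront u ++ z
swapFront-++ (x ∷ y ∷ u) z _           = refl
swapFront-++ (x ∷ [])    z (s≤s ())

swapFront-involutive : ∀ (w : Word) → swapFront (swapFront w) ≡ w
swapFront-involutive []          = refl
swapFront-involutive (x ∷ [])    = refl
swapFront-involutive (x ∷ y ∷ w) = refl

swapLast-involutive : ∀ (w : Word) → swapLast (swapLast w) ≡ w
swapLast-involutive w = begin
  reverse (swapFront (reverse (reverse (swapFront (reverse w)))))
    ≡⟨ cong (λ u → reverse (swapFront u)) (reverse-involutive (swapFront (reverse w))) ⟩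
  reverse (swapFront (swapFront (reverse w)))
    ≡⟨ cong reverse (swapFront-involutive (reverse w)) ⟩
  reverse (reverse w)
    ≡⟨ reverse-involutive w ⟩
  w ∎

swapLast-++ : ∀ (u v : Word) → 2 ≤ length v → swapLast (u ++ v) ≡ u ++ swapLast v
swapLast-++ u v 2≤|v| = begin
  reverse (swapFront (reverse (u ++ v)))
    ≡⟨ cong (λ z → reverse (swapFront z)) (reverse-++ u v) ⟩
  reverse (swapFront (reverse v ++ reverse u))
    ≡⟨ cong reverse (swapFront-++ (reverse v) (reverse u) 2≤|rev-v|) ⟩
  reverse (swapFront (reverse v) ++ reverse u)
    ≡⟨ reverse-++ (swapFront (reverse v)) (reverse u) ⟩
  reverse (reverse u) ++ swapLast v
    ≡⟨ cong (_++ swapLast v) (reverse-involutive u) ⟩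
  u ++ swapLast v ∎
  where
  2≤|rev-v| : 2 ≤ length (reverse v)
  2≤|rev-v| = subst (2 ≤_) (sym (length-reverse v)) 2≤|v|

swapLast-++-pair : ∀ (p : Word) x y → swapLast (p ++ x ∷ y ∷ []) ≡ p ++ y ∷ x ∷ []
swapLast-++-pair p x y = begin
  reverse (swapFront (reverse (p ++ x ∷ y ∷ [])))
    ≡⟨ cong (λ z → reverse (swapFront z)) (reverse-++ p (x ∷ y ∷ [])) ⟩
  reverse (x ∷ y ∷ reverse p)
    ≡⟨ reverse-++ (x ∷ y ∷ []) (reverse p) ⟩
  reverse (reverse p) ++ y ∷ x ∷ []
    ≡⟨ cong (_++ y ∷ x ∷ []) (reverse-involutive p) ⟩
  p ++ y ∷ x ∷ [] ∎

-- The word beginning with F and ending with T, the two overlapping in w; Iw m is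
-- definitionally overlapJoin (fib m) (ww m) (tw m).
overlapJoin : Word → Word → Word → Word
overlapJoin F w T = take (length F ∸ length w) F ++ w ++ drop (length w) T

take-length-++ : ∀ (X w : Word) → take (length X) (X ++ w) ≡ X
take-length-++ []      w = refl
take-length-++ (x ∷ X) w = cong (x ∷_) (take-length-++ X w)

drop-length-++ : ∀ (w z : Word) → drop (length w) (w ++ z) ≡ z
drop-length-++ []      z = refl
drop-length-++ (x ∷ w) z = drop-length-++ w z

overlapJoin-≡ : ∀ {F T X w z : Word} → F ≡ X ++ w → T ≡ w ++ z → overlapJoin F w T ≡ X ++ T
overlapJoin-≡ {X = X} {w} {z} refl refl
  rewrite length-++ X {w} | m+n∸n≡m (length X) (length w)
        | take-length-++ X w | drop-length-++ w z = refl

overlapJoin-power : ∀ {H K Y : Word} → H ≡ K ++ Y → 2 ≤ length K → ∀ e → 2 ≤ e →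
  overlapJoin (H ^ʷ e ++ K) (H ^ʷ (e ∸ 2) ++ K) (swapLast (H ^ʷ e ++ K))
    ≡ (H ++ H) ++ swapLast (H ^ʷ e ++ K)
overlapJoin-power H≡KY 2≤|K| (suc zero) (s≤s ())
overlapJoin-power {H} {K} {Y} H≡KY 2≤|K| (suc (suc e)) _ =
  overlapJoin-≡ prefix (trans (cong swapLast suffix) (swapLast-++ (H ^ʷ e ++ K) Z 2≤|Z|))
  where
  Z = Y ++ H ++ K

  2≤|Z| : 2 ≤ length Z
  2≤|Z| = ≤-trans 2≤|K| (≤-trans (length-++-≤ʳ K {H}) (length-++-≤ʳ (H ++ K) {Y}))

  prefix : H ^ʷ suc (suc e) ++ K ≡ (H ++ H) ++ H ^ʷ e ++ K
  prefix = trans (++-assoc H (H ++ H ^ʷ e) K)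
             (trans (cong (H ++_) (++-assoc H (H ^ʷ e) K)) (sym (++-assoc H H _)))

  suffix : H ^ʷ suc (suc e) ++ K ≡ (H ^ʷ e ++ K) ++ Z
  suffix = begin
    H ^ʷ suc (suc e) ++ K
      ≡⟨ cong (_++ K) (trans (^ʷ-suc H (suc e)) (cong (_++ H) (^ʷ-suc H e))) ⟩
    ((H ^ʷ e ++ H) ++ H) ++ K
      ≡⟨ trans (++-assoc (H ^ʷ e ++ H) H K) (++-assoc (H ^ʷ e) H (H ++ K)) ⟩
    H ^ʷ e ++ H ++ H ++ K
      ≡⟨ cong (λ u → H ^ʷ e ++ u ++ H ++ K) H≡KY ⟩
    H ^ʷ e ++ (K ++ Y) ++ H ++ K
      ≡⟨ cong (H ^ʷ e ++_) (++-assoc K Y (H ++ K)) ⟩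
    H ^ʷ e ++ K ++ Z
      ≡⟨ sym (++-assoc (H ^ʷ e) K Z) ⟩
    (H ^ʷ e ++ K) ++ Z ∎

fib-length≥1 : ∀ a b k → 1 ≤ length (fib a b k)
fib-length≥1 a b zero          = s≤s z≤n
fib-length≥1 a b (suc zero)    = ≤-trans (s≤s z≤n) (length-++-≤ʳ (true ∷ []) {(false ∷ []) ^ʷ (a ∸ 1)})
fib-length≥1 a b (suc (suc k)) = ≤-trans (fib-length≥1 a b k) (length-++-≤ʳ (fib a b k) {fib a b (suc k) ^ʷ sel k a b})

swapLast-fib-++-fib-suc : ∀ a b j →
  swapLast (fib a b j ++ fib a b (suc j)) ≡ fib a b (suc j) ++ fib a b j
swapLast-fib-++-fib-suc a b zero = begin
  swapLast (O ++ O ^ʷ (a ∸ 1) ++ true ∷ [])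
    ≡⟨ cong swapLast (sym (++-assoc O (O ^ʷ (a ∸ 1)) _)) ⟩
  swapLast (O ^ʷ suc (a ∸ 1) ++ true ∷ [])
    ≡⟨ cong (λ u → swapLast (u ++ true ∷ [])) (^ʷ-suc O (a ∸ 1)) ⟩
  swapLast ((O ^ʷ (a ∸ 1) ++ O) ++ true ∷ [])
    ≡⟨ cong swapLast (++-assoc (O ^ʷ (a ∸ 1)) O _) ⟩
  swapLast (O ^ʷ (a ∸ 1) ++ false ∷ true ∷ [])
    ≡⟨ swapLast-++-pair (O ^ʷ (a ∸ 1)) false true ⟩
  O ^ʷ (a ∸ 1) ++ true ∷ false ∷ []
    ≡⟨ sym (++-assoc (O ^ʷ (a ∸ 1)) (true ∷ []) O) ⟩
  (O ^ʷ (a ∸ 1) ++ true ∷ []) ++ O ∎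
  where O = false ∷ []
swapLast-fib-++-fib-suc a b (suc j) = begin
  swapLast (F₁ ++ F₁ ^ʷ e ++ F₀)
    ≡⟨ cong swapLast (sym (++-assoc F₁ (F₁ ^ʷ e) F₀)) ⟩
  swapLast (F₁ ^ʷ suc e ++ F₀)
    ≡⟨ cong (λ u → swapLast (u ++ F₀)) (^ʷ-suc F₁ e) ⟩
  swapLast ((F₁ ^ʷ e ++ F₁) ++ F₀)
    ≡⟨ cong swapLast (++-assoc (F₁ ^ʷ e) F₁ F₀) ⟩
  swapLast (F₁ ^ʷ e ++ F₁ ++ F₀)
    ≡⟨ swapLast-++ (F₁ ^ʷ e) (F₁ ++ F₀) 2≤|F₁F₀| ⟩
  F₁ ^ʷ e ++ swapLast (F₁ ++ F₀)
    ≡⟨ cong (λ u → F₁ ^ʷ e ++ swapLast u) (sym (swapLast-fib-++-fib-suc a b j)) ⟩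
  F₁ ^ʷ e ++ swapLast (swapLast (F₀ ++ F₁))
    ≡⟨ cong (F₁ ^ʷ e ++_) (swapLast-involutive (F₀ ++ F₁)) ⟩
  F₁ ^ʷ e ++ F₀ ++ F₁
    ≡⟨ sym (++-assoc (F₁ ^ʷ e) F₀ F₁) ⟩
  (F₁ ^ʷ e ++ F₀) ++ F₁ ∎
  where
  F₁ = fib a b (suc j)
  F₀ = fib a b j
  e  = sel j a b

  2≤|F₁F₀| : 2 ≤ length (F₁ ++ F₀)
  2≤|F₁F₀| = ≤-trans (+-mono-≤ (fib-length≥1 a b (suc j)) (fib-length≥1 a b j))
               (≤-reflexive (sym (length-++ F₁)))

module _ {a b : ℕ} (2≤a : 2 ≤ a) (2≤b : 2 ≤ b) where

  fib-suc-prefix : ∀ k → ∃[ Y ] fib a b (suc (suc k)) ≡ fib a b (suc k) ++ Y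
  fib-suc-prefix k = split (sel k a b) (sel-≥ k (<⇒≤ 2≤a) (<⇒≤ 2≤b))
    where
    split : ∀ e → 1 ≤ e → ∃[ Y ] fib a b (suc k) ^ʷ e ++ fib a b k ≡ fib a b (suc k) ++ Y
    split (suc e) _ = _ , ++-assoc (fib a b (suc k)) (fib a b (suc k) ^ʷ e) (fib a b k)

  fib-length≥2 : ∀ k → 2 ≤ length (fib a b (suc k))
  fib-length≥2 zero    = length-fib-1 a 2≤a
    where
    length-fib-1 : ∀ c → 2 ≤ c → 2 ≤ length (fib c b 1)
    length-fib-1 (suc zero)    (s≤s ())
    length-fib-1 (suc (suc c)) _ = s≤s (length-++-≤ʳ (true ∷ []) {(false ∷ []) ^ʷ c})
  fib-length≥2 (suc k) with fib-suc-prefix k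
  ... | Y , eq = ≤-trans (fib-length≥2 k)
                   (≤-trans (length-++-≤ˡ (fib a b (suc k)) {Y}) (≤-reflexive (cong length (sym eq))))

  fib-suc-++-fib : ∀ j → fib a b (suc j) ++ fib a b j ≡ fib a b j ++ tw a b (suc j)
  fib-suc-++-fib j = trans (sym (swapLast-fib-++-fib-suc a b j))
                           (swapLast-++ (fib a b j) (fib a b (suc j)) (fib-length≥2 j))

  Iw≡fib++fib++tw : ∀ q → Iw a b (3 + q) ≡ (fib a b (2 + q) ++ fib a b (2 + q)) ++ tw a b (3 + q)
  Iw≡fib++fib++tw q =
    overlapJoin-power (proj₂ (fib-suc-prefix q)) (fib-length≥2 q) (sel (suc q) a b) (sel-≥ (suc q) 2≤a 2≤b)

mainTheorem5 : (a b n h : ℕ) → 2 ≤ a → 2 ≤ b → 7 ≤ n →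
    sel n a b ≡ 2 * h →
    fib a b n ≡
      ((fib a b (n ∸ 2) ^ʷ sel n b a) ++ Iw a b (n ∸ 2)
        ++ (tw a b (n ∸ 2) ^ʷ (sel n b a ∸ 1))) ^ʷ h
      ++ fib a b (n ∸ 2)
mainTheorem5 a b (suc (suc (suc (suc (suc q))))) h 2≤a 2≤b (s≤s (s≤s (s≤s (s≤s (s≤s _))))) r≡2h = begin
  F ^ʷ sel (suc q) a b ++ G   ≡⟨ cong (λ k → F ^ʷ k ++ G) r≡2h ⟩
  F ^ʷ (2 * h) ++ G           ≡⟨ cong (_++ G) (^ʷ-2* F h) ⟩
  (F ++ F) ^ʷ h ++ G          ≡⟨ cong (λ u → u ^ʷ h ++ G) (sym block≡FF) ⟩
  block ^ʷ h ++ G             ∎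
  where
  G = fib a b (3 + q)
  H = fib a b (2 + q)
  T = tw a b (3 + q)
  F = fib a b (4 + q)
  s = sel (suc q) b a
  block = G ^ʷ s ++ Iw a b (3 + q) ++ T ^ʷ (s ∸ 1)

  F≡GˢH : F ≡ G ^ʷ s ++ H
  F≡GˢH = cong (λ k → G ^ʷ k ++ H) (sym (sel-suc q b a))

  block≡FF : block ≡ F ++ F
  block≡FF = begin
    G ^ʷ s ++ Iw a b (3 + q) ++ T ^ʷ (s ∸ 1)
      ≡⟨ cong (λ u → G ^ʷ s ++ u ++ T ^ʷ (s ∸ 1)) (Iw≡fib++fib++tw 2≤a 2≤b q) ⟩
    G ^ʷ s ++ ((H ++ H) ++ T) ++ T ^ʷ (s ∸ 1)
      ≡⟨ conjugate-block (fib-suc-++-fib 2≤a 2≤b (2 + q)) s (sel-≥ (suc q) (<⇒≤ 2≤b) (<⇒≤ 2≤a)) ⟩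
    (G ^ʷ s ++ H) ++ (G ^ʷ s ++ H)
      ≡⟨ cong (λ u → u ++ u) (sym F≡GˢH) ⟩
    F ++ F ∎
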